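{- Let $\Gamma=(\mathfrak{p}^{\mu_{ij}})\subseteq M_n(D)$ be a tiled order containing $\mathrm{diag}(\Delta,\dots,\Delta)$, let $\sigma\in H$ and $\xi_\sigma=(\boldsymbol{\pi}^{\mu_{i1}-\mu_{\sigma(i)\sigma(1)}}\delta_{\sigma(i)j})$. Write $\sigma=\sigma_1\cdots\sigma_s$ as a product of disjoint cycles (fixed points counted as cycles of length $1$) of lengths $l_1,\dots,l_s$. If some $l_i$ satisfies $\gcd(l_i,n)=1$, then $t(\xi_\sigma)\equiv 0\pmod n$.
   Context: Setting: $k$ non-archimedean local field of characteristic $0$; $D$ central division algebra over $k$ with maximal order $\Delta$, prime element $\boldsymbol{\pi}$, $\mathfrak{p}=\boldsymbol{\pi}\Delta$. $\Gamma=(\mathfrak{p}^{\mu_{ij}})$ with $\mu_{ij}\in\mathbb{Z}$, $\mu_{ii}=0$, $\mu_{ij}+\mu_{j\ell}\ge\mu_{i\ell}$; structural invariants $m_{ij\ell}=\mu_{ij}+\mu_{j\ell}-\mu_{i\ell}$; $H=\{\sigma\in S_n: m_{ij\ell}=m_{\sigma(i)\sigma(j)\sigma(\ell)}\ \forall i,j,\ell\}$. The type of a monomial matrix $(\boldsymbol{\pi}^{\alpha_i}\delta_{\sigma(i)j})$ is $\sum_i\alpha_i\bmod n$. -}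

module Defs where

open import Data.Nat using (ℕ; zero; suc)
open import Data.Fin using (Fin; zero; suc)
open import Data.Integer using (ℤ; _+_; _-_; _≤_; 0ℤ)
open import Data.Fin.Permutation using (Permutation′; _⟨$⟩ʳ_)
open import Data.Product using (_×_)
open import Relation.Binary.PropositionalEquality using (_≡_; _≢_)
open import Relation.Nullary using (¬_)

-- Exponent matrix μ of a tiled order Γ = (p^{μ i j}) ⊆ M_n(D) containing
-- diag(Δ,…,Δ): μ i i = 0 and μ i j + μ j l ≥ μ i l.
record IsTiledExponent {n : ℕ} (μ : Fin n → Fin n → ℤ) : Set where
  field
    diag-zero : ∀ i → μ i i ≡ 0ℤ
    triangle  : ∀ i j l → μ i l ≤ μ i j + μ j l

structInv : {n : ℕ} → (Fin n → Fin n → ℤ) → Fin n → Fin n → Fin n → ℤ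
structInv μ i j l = (μ i j + μ j l) - μ i l

InH : {n : ℕ} → (Fin n → Fin n → ℤ) → Permutation′ n → Set
InH μ σ = ∀ i j l →
  structInv μ i j l ≡ structInv μ (σ ⟨$⟩ʳ i) (σ ⟨$⟩ʳ j) (σ ⟨$⟩ʳ l)

iter : {n : ℕ} → Permutation′ n → ℕ → Fin n → Fin n
iter σ zero    i = i
iter σ (suc k) i = σ ⟨$⟩ʳ (iter σ k i)

IsCycleLength : {n : ℕ} → Permutation′ n → Fin n → ℕ → Set
IsCycleLength σ i l =
  (0 Data.Nat.< l) × (iter σ l i ≡ i) ×
  (∀ k → 0 Data.Nat.< k → k Data.Nat.< l → iter σ k i ≢ i)

sumFin : (n : ℕ) → (Fin n → ℤ) → ℤ
sumFin zero    f = 0ℤ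
sumFin (suc n) f = f zero + sumFin n (λ i → f (suc i))

-- Type of ξ_σ = (π^{μ_{i1} - μ_{σ(i)σ(1)}} δ_{σ(i)j}) in M_{suc m}(D):
-- the sum of exponents Σ_i (μ_{i1} - μ_{σ(i)σ(1)}) (to be read mod n).
-- Index 1 of the paper is Fin.zero.
typeXi : (m : ℕ) → (Fin (suc m) → Fin (suc m) → ℤ) → Permutation′ (suc m) → ℤ
typeXi m μ σ = sumFin (suc m) (λ i → μ i zero - μ (σ ⟨$⟩ʳ i) (σ ⟨$⟩ʳ zero))

-- Invariance of the structural invariants m_{i j 1} under σ says exactly that
-- μ_{σ(i)σ(j)} = μ_{ij} + e_j − e_i, where e_i = μ_{i1} − μ_{σ(i)σ(1)} are the
-- exponents of ξ_σ, so that t(ξ_σ) = Σ e_i. Summing over j, the row sums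
-- R_i = Σ_j μ_{ij} satisfy R_{σ(i)} ≡ R_i + t (mod n). Going once around a
-- cycle of length l gives l t ≡ 0 (mod n), hence n ∣ t when gcd(l, n) = 1.
module Submission where

open import Defs
open import Data.Nat using (ℕ; zero; suc)
open import Data.Nat.GCD using (gcd)
import Data.Nat.Coprimality as ℕ
open import Data.Fin using (Fin; zero; suc)
open import Data.Integer using (ℤ; +_; 0ℤ; _+_; _-_; _*_)
open import Data.Integer.Properties using (+-*-semiring; +-0-abelianGroup; suc-*; +-assoc; +-comm; *-comm; *-zeroˡ; *-zeroʳ)
open import Data.Integer.Divisibility using (_∣_)
open import Data.Integer.Divisibility.Signed using (divides; ∣⇒∣ᵤ)
open import Data.Integer.Coprimality using (coprime-divisor)
open import Data.Integer.Tactic.RingSolver using (solve)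
open import Algebra.Bundles using (AbelianGroup)
open import Algebra.Properties.Group (AbelianGroup.group +-0-abelianGroup) using (∙-cancelˡ)
open import Algebra.Properties.Semiring.Sum +-*-semiring using (sum; sum-syntax; sum-cong-≗; ∑-distrib-+; ∑-permute)
open import Data.Fin.Permutation using (Permutation′; _⟨$⟩ʳ_)
open import Data.List using (_∷_; [])
open import Data.Product using (∃; ∃₂; _×_; _,_)
open import Relation.Binary.PropositionalEquality using (_≡_; refl; sym; trans; cong; cong₂; subst; module ≡-Reasoning)
open ≡-Reasoning

sumFin≡sum : ∀ n (f : Fin n → ℤ) → sumFin n f ≡ sum f
sumFin≡sum zero    f = refl
sumFin≡sum (suc n) f = cong (_+_ (f zero)) (sumFin≡sum n (λ i → f (suc i)))

sum-const : ∀ n (x : ℤ) → sum {n} (λ _ → x) ≡ + n * x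
sum-const zero    x = refl
sum-const (suc n) x = trans (cong (_+_ x) (sum-const n x)) (sym (suc-* (+ n) x))

telescope-step : ∀ r r′ s N v q c →
  r′ + N * v ≡ r + c → r + N * q ≡ s → r′ + N * (v + q) ≡ s + c
telescope-step r r′ s N v q c step acc = begin
  r′ + N * (v + q)    ≡⟨ solve (r′ ∷ N ∷ v ∷ q ∷ []) ⟩
  (r′ + N * v) + N * q ≡⟨ cong (_+ N * q) step ⟩
  (r + c) + N * q     ≡⟨ solve (r ∷ c ∷ N ∷ q ∷ []) ⟩
  (r + N * q) + c     ≡⟨ cong (_+ c) acc ⟩
  s + c               ∎

module _ {n : ℕ} (σ : Permutation′ n) (R h : Fin n → ℤ) (N : ℕ) (c : ℤ)
         (drift : ∀ i → R (σ ⟨$⟩ʳ i) + + N * h i ≡ R i + c) where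

  iter-drift : ∀ k x → ∃ λ q → R (iter σ k x) + + N * q ≡ R x + + k * c
  iter-drift zero    x = 0ℤ , cong (_+_ (R x)) (trans (*-zeroʳ (+ N)) (sym (*-zeroˡ c)))
  iter-drift (suc k) x with iter-drift k x
  ... | q , acc = h y + q , (begin
    R (σ ⟨$⟩ʳ y) + + N * (h y + q) ≡⟨ telescope-step (R y) (R (σ ⟨$⟩ʳ y)) _ (+ N) (h y) q c (drift y) acc ⟩
    (R x + + k * c) + c           ≡⟨ +-assoc (R x) (+ k * c) c ⟩
    R x + (+ k * c + c)           ≡⟨ cong (_+_ (R x)) (+-comm (+ k * c) c) ⟩
    R x + (c + + k * c)           ≡⟨ cong (_+_ (R x)) (suc-* (+ k) c) ⟨
    R x + + suc k * c             ∎)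
    where
    y = iter σ k x

  coprime-cycle⇒∣ : ∀ x l → iter σ l x ≡ x → gcd l N ≡ 1 → + N ∣ c
  coprime-cycle⇒∣ x l σˡx≡x gcd≡1 with iter-drift l x
  ... | q , eq = coprime-divisor (+ N) (+ l) c (ℕ.sym (ℕ.gcd≡1⇒coprime gcd≡1))
                   (∣⇒∣ᵤ (divides q lc≡qN))
    where
    lc≡qN : + l * c ≡ q * + N
    lc≡qN = ∙-cancelˡ (R x) _ _ (begin
      R x + + l * c             ≡⟨ eq ⟨
      R (iter σ l x) + + N * q  ≡⟨ cong₂ _+_ (cong R σˡx≡x) (*-comm (+ N) q) ⟩
      R x + q * + N             ∎)

structInv-balance : ∀ a b c a′ b′ c′ →
  (a + b) - c ≡ (a′ + b′) - c′ → a′ + (c - c′) ≡ a + (b - b′)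
structInv-balance a b c a′ b′ c′ eq = begin
  a′ + (c - c′)               ≡⟨ solve (a′ ∷ b′ ∷ c ∷ c′ ∷ []) ⟩
  ((a′ + b′) - c′) + (c - b′) ≡⟨ cong (_+ (c - b′)) eq ⟨
  ((a + b) - c) + (c - b′)    ≡⟨ solve (a ∷ b ∷ c ∷ b′ ∷ []) ⟩
  a + (b - b′)                ∎

rowSum : ∀ {n} → (Fin n → Fin n → ℤ) → Fin n → ℤ
rowSum μ i = sum (μ i)

module _ {n : ℕ} (μ : Fin n → Fin n → ℤ) (σ : Permutation′ n) where

  xiExponent : Fin n → Fin n → ℤ
  xiExponent k i = μ i k - μ (σ ⟨$⟩ʳ i) (σ ⟨$⟩ʳ k)

  InH⇒coboundary : InH μ σ → ∀ k i j →
    μ (σ ⟨$⟩ʳ i) (σ ⟨$⟩ʳ j) + xiExponent k i ≡ μ i j + xiExponent k j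
  InH⇒coboundary inH k i j = structInv-balance (μ i j) (μ j k) (μ i k)
    (μ (σ ⟨$⟩ʳ i) (σ ⟨$⟩ʳ j)) (μ (σ ⟨$⟩ʳ j) (σ ⟨$⟩ʳ k)) (μ (σ ⟨$⟩ʳ i) (σ ⟨$⟩ʳ k)) (inH i j k)

  rowSum-drift : InH μ σ → ∀ k i →
    rowSum μ (σ ⟨$⟩ʳ i) + + n * xiExponent k i ≡ rowSum μ i + sum (xiExponent k)
  rowSum-drift inH k i = begin
    rowSum μ (σ ⟨$⟩ʳ i) + + n * e i
      ≡⟨ cong₂ _+_ (∑-permute (μ (σ ⟨$⟩ʳ i)) σ) (sym (sum-const n (e i))) ⟩
    ∑[ j < n ] μ (σ ⟨$⟩ʳ i) (σ ⟨$⟩ʳ j) + ∑[ j < n ] e i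
      ≡⟨ ∑-distrib-+ (λ j → μ (σ ⟨$⟩ʳ i) (σ ⟨$⟩ʳ j)) (λ _ → e i) ⟨
    ∑[ j < n ] (μ (σ ⟨$⟩ʳ i) (σ ⟨$⟩ʳ j) + e i)
      ≡⟨ sum-cong-≗ (InH⇒coboundary inH k i) ⟩
    ∑[ j < n ] (μ i j + e j)
      ≡⟨ ∑-distrib-+ (μ i) e ⟩
    rowSum μ i + sum e ∎
    where
    e = xiExponent k

lemma3p2 : (m : ℕ) (μ : Fin (suc m) → Fin (suc m) → ℤ) → IsTiledExponent μ →
    (σ : Permutation′ (suc m)) → InH μ σ →
    (∃₂ λ (i : Fin (suc m)) (l : ℕ) → IsCycleLength σ i l × gcd l (suc m) ≡ 1) →
    (+ (suc m)) ∣ typeXi m μ σ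
lemma3p2 m μ _ σ inH (x , l , (_ , σˡx≡x , _) , gcd≡1) =
  subst (+ suc m ∣_) (sym (sumFin≡sum (suc m) e))
    (coprime-cycle⇒∣ σ (rowSum μ) e (suc m) (sum e) (rowSum-drift μ σ inH zero) x l σˡx≡x gcd≡1)
  where
  e = xiExponent μ σ zero
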